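{- Let $X$ be a finite set of variables, $\preceq$ a monomial ordering, and $Z,P\subseteq\mathbb{Q}[X]$ finite sets of polynomials such that $\langle Z,P\rangle$ is reduced with respect to $\preceq$. Suppose $q \in \mathrm{alg.cone}(Z,P)$ is written as $q = z + p$ with $z \in \langle Z\rangle$ and $p\in\mathrm{cone}(P)$. Then $\mathrm{Lm}(z) \preceq \mathrm{Lm}(q)$ and $\mathrm{Lm}(p)\preceq\mathrm{Lm}(q)$.
   Context: $\mathrm{Lm}(f)$ is the leading monomial of a polynomial $f$ with respect to $\preceq$ (the $\preceq$-greatest monomial occurring in $f$ with non-zero coefficient). $\langle Z\rangle$ is the ideal of $\mathbb{Q}[X]$ generated by $Z$, $\mathrm{cone}(P)$ is the set of non-negative rational combinations of elements of $P$, and $\mathrm{alg.cone}(Z,P) = \langle Z\rangle+\mathrm{cone}(P)$. The pair $\langle Z,P\rangle$ is reduced w.r.t. $\preceq$ if $Z$ is a Gröbner basis of $\langle Z\rangle$ w.r.t. $\preceq$ and every $p\in P$ equals its normal form modulo $Z$ (no monomial of $p$ is divisible by the leading monomial of an element of $Z$). -}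

module Defs where

open import Level using (0ℓ)
open import Data.Nat as ℕ using (ℕ)
open import Data.Rational as ℚ using (ℚ; 0ℚ)
open import Data.Vec using (Vec; zipWith; replicate)
open import Data.Vec.Properties using (≡-dec)
open import Data.List using (List; []; _∷_; _++_; concatMap; map; filter)
open import Data.List.Membership.Propositional using (_∈_)
open import Data.List.Relation.Unary.All using (All)
open import Data.Product using (_×_; _,_; ∃; ∃-syntax; proj₁; proj₂)
open import Data.Sum using (_⊎_; inj₁; inj₂)
open import Data.Maybe using (Maybe; just; nothing)
open import Data.Unit using (⊤)
open import Data.Empty using (⊥)
open import Relation.Nullary using (¬_; yes; no)
open import Relation.Binary.PropositionalEquality using (_≡_; _≢_)
open import Relation.Binary.Structures using (IsTotalOrder)
open import Induction.WellFounded using (WellFounded)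

-- Variables X = Fin n; a monomial x^α is its exponent vector α ∈ ℕⁿ.
Mono : ℕ → Set
Mono n = Vec ℕ n

_≟ᴹ_ : ∀ {n} (a b : Mono n) → Relation.Nullary.Dec (a ≡ b)
_≟ᴹ_ = ≡-dec ℕ._≟_

_·ᴹ_ : ∀ {n} → Mono n → Mono n → Mono n
_·ᴹ_ = zipWith ℕ._+_

oneᴹ : ∀ {n} → Mono n
oneᴹ = replicate _ 0

_∣ᴹ_ : ∀ {n} → Mono n → Mono n → Set
a ∣ᴹ b = ∃[ c ] (a ·ᴹ c ≡ b)

record MonomialOrder (n : ℕ) : Set₁ where
  field
    _≼_        : Mono n → Mono n → Set
    isTotalOrder : IsTotalOrder _≡_ _≼_
    mult       : ∀ {a b} c → a ≼ b → (a ·ᴹ c) ≼ (b ·ᴹ c)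
    wellOrder  : WellFounded (λ a b → (a ≼ b) × (a ≢ b))
  open IsTotalOrder isTotalOrder public using (total)

-- Polynomials in ℚ[x₁..xₙ], represented by finite lists of terms (c , α) meaning Σ c·x^α.
-- Two representations denote the same polynomial iff all coefficients agree (_≃_).
Poly : ℕ → Set
Poly n = List (ℚ × Mono n)

coeff : ∀ {n} → Poly n → Mono n → ℚ
coeff [] m = 0ℚ
coeff ((c , α) ∷ f) m with α ≟ᴹ m
... | yes _ = c ℚ.+ coeff f m
... | no _  = coeff f m

_≃_ : ∀ {n} → Poly n → Poly n → Set
f ≃ g = ∀ m → coeff f m ≡ coeff g m

zeroP : ∀ {n} → Poly n
zeroP = []

_⊕_ : ∀ {n} → Poly n → Poly n → Poly n
_⊕_ = _++_

_⊗_ : ∀ {n} → Poly n → Poly n → Poly n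
f ⊗ g = concatMap (λ { (c , α) → map (λ { (d , β) → (c ℚ.* d , α ·ᴹ β) }) g }) f

_⊙_ : ∀ {n} → ℚ → Poly n → Poly n
r ⊙ f = map (λ { (c , α) → (r ℚ.* c , α) }) f

Occurs : ∀ {n} → Mono n → Poly n → Set
Occurs m f = coeff f m ≢ 0ℚ

module _ {n : ℕ} (O : MonomialOrder n) where
  open MonomialOrder O

  private
    maxᴹ : Mono n → Mono n → Mono n
    maxᴹ a b with total a b
    ... | inj₁ _ = b
    ... | inj₂ _ = a

    maxL : Maybe (Mono n) → List (Mono n) → Maybe (Mono n)
    maxL acc [] = acc
    maxL nothing (m ∷ ms) = maxL (just m) ms
    maxL (just a) (m ∷ ms) = maxL (just (maxᴹ a m)) ms

  -- Leading monomial: the ≼-greatest monomial with nonzero coefficient;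
  -- Lm of the zero polynomial is `nothing`.
  Lm : Poly n → Maybe (Mono n)
  Lm f = maxL nothing (filter (λ m → Relation.Nullary.¬? (coeff f m ℚ.≟ 0ℚ)) (map proj₂ f))

  _≼?_ : Maybe (Mono n) → Maybe (Mono n) → Set
  nothing ≼? _ = ⊤
  just a ≼? nothing = ⊥
  just a ≼? just b = a ≼ b

  sumP : List (Poly n) → Poly n
  sumP [] = zeroP
  sumP (f ∷ fs) = f ⊕ sumP fs

  InIdeal : List (Poly n) → Poly n → Set
  InIdeal Z f = ∃[ hs ] (All (λ hg → proj₂ hg ∈ Z) hs
                         × f ≃ sumP (map (λ hg → proj₁ hg ⊗ proj₂ hg) hs))

  InCone : List (Poly n) → Poly n → Set
  InCone P f = ∃[ cs ] (All (λ cp → (0ℚ ℚ.≤ proj₁ cp) × (proj₂ cp ∈ P)) cs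
                        × f ≃ sumP (map (λ cp → proj₁ cp ⊙ proj₂ cp) cs))

  IsGroebner : List (Poly n) → Set
  IsGroebner Z = ∀ f → InIdeal Z f → ∀ m → Lm f ≡ just m →
                 ∃[ g ] (g ∈ Z × ∃[ l ] (Lm g ≡ just l × l ∣ᴹ m))

  -- p equals its normal form modulo Z: no monomial of p is divisible by Lm(g), g ∈ Z.
  IsNormal : List (Poly n) → Poly n → Set
  IsNormal Z p = ∀ g → g ∈ Z → ∀ l → Lm g ≡ just l → ∀ m → Occurs m p → ¬ (l ∣ᴹ m)

  Reduced : List (Poly n) → List (Poly n) → Set
  Reduced Z P = IsGroebner Z × All (IsNormal Z) P

{-# OPTIONS --safe #-}
-- Every monomial of an element of cone(P) occurs in some element of P, so p is again in
-- normal form modulo Z. As Z is a Gröbner basis, Lm z is a multiple of some Lm g with g ∈ Z,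
-- hence it does not occur in p and survives in q = z + p: Lm z ⪯ Lm q. The leading monomial
-- of p either survives in q too, or it occurs in z and lies below Lm z ⪯ Lm q.
-- The sign of the cone coefficients plays no role.
module Submission where

open import Defs
open import Data.Nat using (ℕ)
open import Data.List using (List; []; _∷_; filter; map)
open import Data.List.Properties using (filter-all; map-∘; map-id)
open import Data.List.Membership.Propositional using (_∈_)
open import Data.List.Membership.Propositional.Properties using (∈-filter⁺; ∈-filter⁻)
open import Data.List.Relation.Unary.Any using (Any; here; there)
open import Data.List.Relation.Unary.All as All using (All)
open import Data.Product using (_×_; _,_; ∃-syntax; proj₁; proj₂)
open import Data.Sum using (_⊎_; inj₁; inj₂)
open import Data.Maybe using (Maybe; just; nothing)
open import Data.Unit using (tt)
open import Data.Empty using (⊥-elim)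
open import Data.Rational as ℚ using (ℚ; 0ℚ; 1ℚ)
import Data.Rational.Properties as ℚ
open import Relation.Nullary using (¬?; yes; no)
open import Relation.Nullary.Decidable using (decidable-stable)
open import Relation.Binary.PropositionalEquality
open import Relation.Binary.Structures using (IsTotalOrder)

coeff-⊕ : ∀ {n} (f g : Poly n) m → coeff (f ⊕ g) m ≡ coeff f m ℚ.+ coeff g m
coeff-⊕ [] g m = sym (ℚ.+-identityˡ _)
coeff-⊕ ((c , α) ∷ f) g m with α ≟ᴹ m
... | yes _ = trans (cong (c ℚ.+_) (coeff-⊕ f g m)) (sym (ℚ.+-assoc c _ _))
... | no _  = coeff-⊕ f g m

coeff-⊙ : ∀ {n} r (f : Poly n) m → coeff (r ⊙ f) m ≡ r ℚ.* coeff f m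
coeff-⊙ r [] m = sym (ℚ.*-zeroʳ r)
coeff-⊙ r ((c , α) ∷ f) m with α ≟ᴹ m
... | yes _ = trans (cong (r ℚ.* c ℚ.+_) (coeff-⊙ r f m)) (sym (ℚ.*-distribˡ-+ r c _))
... | no _  = coeff-⊙ r f m

occurs-resp-≃ : ∀ {n} (f g : Poly n) {m} → f ≃ g → Occurs m g → Occurs m f
occurs-resp-≃ _ _ f≃g occ f≡0 = occ (trans (sym (f≃g _)) f≡0)

occurs-⊕ˡ : ∀ {n} (f g : Poly n) {m} → coeff g m ≡ 0ℚ → Occurs m f → Occurs m (f ⊕ g)
occurs-⊕ˡ f g {m} g≡0 occ sum≡0 = occ (begin
  coeff f m               ≡⟨ sym (ℚ.+-identityʳ _) ⟩
  coeff f m ℚ.+ 0ℚ        ≡⟨ cong (coeff f m ℚ.+_) (sym g≡0) ⟩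
  coeff f m ℚ.+ coeff g m ≡⟨ sym (coeff-⊕ f g m) ⟩
  coeff (f ⊕ g) m         ≡⟨ sum≡0 ⟩
  0ℚ                      ∎)
  where open ≡-Reasoning

occurs-⊕ʳ : ∀ {n} (f g : Poly n) {m} → coeff f m ≡ 0ℚ → Occurs m g → Occurs m (f ⊕ g)
occurs-⊕ʳ f g {m} f≡0 occ sum≡0 = occ (begin
  coeff g m               ≡⟨ sym (ℚ.+-identityˡ _) ⟩
  0ℚ ℚ.+ coeff g m        ≡⟨ cong (ℚ._+ coeff g m) (sym f≡0) ⟩
  coeff f m ℚ.+ coeff g m ≡⟨ sym (coeff-⊕ f g m) ⟩
  coeff (f ⊕ g) m         ≡⟨ sum≡0 ⟩
  0ℚ                      ∎)
  where open ≡-Reasoning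

occurs-⊕ : ∀ {n} (f g : Poly n) {m} → Occurs m (f ⊕ g) → Occurs m f ⊎ Occurs m g
occurs-⊕ f g {m} occ with coeff f m ℚ.≟ 0ℚ
... | no f≢0  = inj₁ f≢0
... | yes f≡0 = inj₂ λ g≡0 → occ (begin
  coeff (f ⊕ g) m         ≡⟨ coeff-⊕ f g m ⟩
  coeff f m ℚ.+ coeff g m ≡⟨ cong₂ ℚ._+_ f≡0 g≡0 ⟩
  0ℚ                      ∎)
  where open ≡-Reasoning

occurs-⊙ : ∀ {n} r (f : Poly n) {m} → Occurs m (r ⊙ f) → Occurs m f
occurs-⊙ r f {m} occ f≡0 =
  occ (trans (coeff-⊙ r f m) (trans (cong (r ℚ.*_) f≡0) (ℚ.*-zeroʳ r)))

module _ {n : ℕ} (O : MonomialOrder n) where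
  open MonomialOrder O

  ≼-refl : ∀ {a} → a ≼ a
  ≼-refl = IsTotalOrder.refl isTotalOrder

  ≼-trans : ∀ {a b c} → a ≼ b → b ≼ c → a ≼ c
  ≼-trans = IsTotalOrder.trans isTotalOrder

  ≼?-trans : ∀ {a b c} → _≼?_ O a b → _≼?_ O b c → _≼?_ O a c
  ≼?-trans {nothing}                  _   _   = tt
  ≼?-trans {just _} {just _} {just _} a≼b b≼c = ≼-trans a≼b b≼c

  support : Poly n → List (Mono n)
  support f = filter (λ m → ¬? (coeff f m ℚ.≟ 0ℚ)) (map proj₂ f)

  IsMaximum : List (Mono n) → Maybe (Mono n) → Set
  IsMaximum K r = ∃[ a ] (r ≡ just a × a ∈ K × (∀ {b} → b ∈ K → b ≼ a))

  sumMonomials : List (Mono n) → Poly n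
  sumMonomials = map (1ℚ ,_)

  coeff-sumMonomials-nonneg : ∀ K y → 0ℚ ℚ.≤ coeff (sumMonomials K) y
  coeff-sumMonomials-nonneg [] y = ℚ.≤-refl
  coeff-sumMonomials-nonneg (x ∷ K) y with x ≟ᴹ y
  ... | yes _ = ℚ.<⇒≤ (ℚ.+-mono-<-≤ (ℚ.positive⁻¹ 1ℚ) (coeff-sumMonomials-nonneg K y))
  ... | no _  = coeff-sumMonomials-nonneg K y

  coeff-sumMonomials-pos : ∀ K {y} → y ∈ K → 0ℚ ℚ.< coeff (sumMonomials K) y
  coeff-sumMonomials-pos (x ∷ K) {y} y∈K with x ≟ᴹ y | y∈K
  ... | yes _  | _          = ℚ.+-mono-<-≤ (ℚ.positive⁻¹ 1ℚ) (coeff-sumMonomials-nonneg K y)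
  ... | no x≢y | here y≡x   = ⊥-elim (x≢y (sym y≡x))
  ... | no _   | there y∈K′ = coeff-sumMonomials-pos K y∈K′

  support-sumMonomials : ∀ K → support (sumMonomials K) ≡ K
  support-sumMonomials K = begin
    filter occurs? (map proj₂ (sumMonomials K)) ≡⟨ cong (filter occurs?) (sym (map-∘ K)) ⟩
    filter occurs? (map (λ y → y) K)             ≡⟨ cong (filter occurs?) (map-id K) ⟩
    filter occurs? K                             ≡⟨ filter-all occurs? (All.tabulate occurs) ⟩
    K                                            ∎
    where
    open ≡-Reasoning
    occurs? = λ m → ¬? (coeff (sumMonomials K) m ℚ.≟ 0ℚ)
    occurs : ∀ {y} → y ∈ K → Occurs y (sumMonomials K)
    occurs y∈K = ≢-sym (ℚ.<⇒≢ (coeff-sumMonomials-pos K y∈K))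

  -- The fold computing Lm is private to Defs, so it is reached through Lm (sumMonomials K),
  -- which unfolds to that fold over K itself once support-sumMonomials is rewritten.
  Lm-sumMonomials : ∀ x ms → IsMaximum (x ∷ ms) (Lm O (sumMonomials (x ∷ ms)))
  Lm-sumMonomials x [] rewrite support-sumMonomials (x ∷ []) =
    x , refl , here refl , λ { (here refl) → ≼-refl }
  Lm-sumMonomials x (m ∷ ms) rewrite support-sumMonomials (x ∷ m ∷ ms) with total x m
  ... | inj₁ x≼m
    with support (sumMonomials (m ∷ ms)) | support-sumMonomials (m ∷ ms) | Lm-sumMonomials m ms
  ... | _ | refl | a , Lm≡a , a∈ , ub = a , Lm≡a , there a∈ , λ
          { (here refl) → ≼-trans x≼m (ub (here refl))
          ; (there b∈)  → ub b∈ }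
  Lm-sumMonomials x (m ∷ ms) | inj₂ m≼x
    with support (sumMonomials (x ∷ ms)) | support-sumMonomials (x ∷ ms) | Lm-sumMonomials x ms
  ... | _ | refl | a , Lm≡a , a∈ , ub = a , Lm≡a , skip a∈ , λ
          { (here refl)         → ub (here refl)
          ; (there (here refl)) → ≼-trans m≼x (ub (here refl))
          ; (there (there b∈))  → ub (there b∈) }
    where
    skip : ∀ {b} → b ∈ x ∷ ms → b ∈ x ∷ m ∷ ms
    skip (here b≡x) = here b≡x
    skip (there b∈) = there (there b∈)

  Lm-support : ∀ f → (Lm O f ≡ nothing × support f ≡ []) ⊎ IsMaximum (support f) (Lm O f)
  Lm-support f with support f
  ... | []     = inj₁ (refl , refl)
  ... | x ∷ ms with support (sumMonomials (x ∷ ms)) | support-sumMonomials (x ∷ ms)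
                  | Lm-sumMonomials x ms
  ...   | _ | refl | max = inj₂ max

  ∈-support : ∀ {f b} → Occurs b f → b ∈ support f
  ∈-support {f} {b} occ = ∈-filter⁺ (λ m → ¬? (coeff f m ℚ.≟ 0ℚ)) (∈-coefficients f occ) occ
    where
    ∈-coefficients : ∀ f → Occurs b f → b ∈ map proj₂ f
    ∈-coefficients [] occ = ⊥-elim (occ refl)
    ∈-coefficients ((c , α) ∷ f) occ with α ≟ᴹ b
    ... | yes refl = here refl
    ... | no _     = there (∈-coefficients f occ)

  Lm-occurs : ∀ f {a} → Lm O f ≡ just a → Occurs a f
  Lm-occurs f Lm-f with Lm-support f
  ... | inj₁ (Lm-f′ , _) with trans (sym Lm-f) Lm-f′
  ...   | ()
  Lm-occurs f Lm-f | inj₂ (a , Lm-f′ , a∈ , _) with trans (sym Lm-f) Lm-f′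
  ...   | refl = proj₂ (∈-filter⁻ (λ m → ¬? (coeff f m ℚ.≟ 0ℚ)) {xs = map proj₂ f} a∈)

  occurs⇒≼Lm : ∀ f {b} → Occurs b f → _≼?_ O (just b) (Lm O f)
  occurs⇒≼Lm f occ with Lm O f | Lm-support f | ∈-support {f} occ
  ... | _ | inj₁ (_ , support≡[]) | b∈ with subst (_ ∈_) support≡[] b∈
  ...   | ()
  occurs⇒≼Lm f occ | _ | inj₂ (a , refl , _ , ub) | b∈ = ub b∈

  linearCombination : List (ℚ × Poly n) → Poly n
  linearCombination cs = sumP O (map (λ cp → proj₁ cp ⊙ proj₂ cp) cs)

  occurs-linearCombination : ∀ cs {m} → Occurs m (linearCombination cs) →
                             Any (λ cp → Occurs m (proj₂ cp)) cs
  occurs-linearCombination [] occ = ⊥-elim (occ refl)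
  occurs-linearCombination ((c , p) ∷ cs) occ with occurs-⊕ (c ⊙ p) (linearCombination cs) occ
  ... | inj₁ occ-cp   = here (occurs-⊙ c p occ-cp)
  ... | inj₂ occ-rest = there (occurs-linearCombination cs occ-rest)

  IsNormal-linearCombination : ∀ {Z} cs → All (λ cp → IsNormal O Z (proj₂ cp)) cs →
                               IsNormal O Z (linearCombination cs)
  IsNormal-linearCombination cs normal g g∈Z l Lm-g m occ
    with All.lookupAny normal (occurs-linearCombination cs occ)
  ... | normal-p , occ-p = normal-p g g∈Z l Lm-g m occ-p

  IsNormal-cone : ∀ Z {P} p → All (IsNormal O Z) P → InCone O P p → IsNormal O Z p
  IsNormal-cone Z p normal (cs , cs∈P , p≃) g g∈Z l Lm-g m occ =
    IsNormal-linearCombination cs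
      (All.map (λ cp∈P → All.lookup normal (proj₂ cp∈P)) cs∈P)
      g g∈Z l Lm-g m (occurs-resp-≃ (linearCombination cs) p (λ m′ → sym (p≃ m′)) occ)

  coeff-normal-at-Lm-ideal≡0 : ∀ Z z p {a} → IsGroebner O Z → InIdeal O Z z → IsNormal O Z p →
                               Lm O z ≡ just a → coeff p a ≡ 0ℚ
  coeff-normal-at-Lm-ideal≡0 Z z p {a} groebner z∈⟨Z⟩ p-normal Lm-z =
    decidable-stable (coeff p a ℚ.≟ 0ℚ) λ occ →
      let g , g∈Z , l , Lm-g , l∣a = groebner z z∈⟨Z⟩ a Lm-z
      in p-normal g g∈Z l Lm-g a occ l∣a

lemma3p8 : (n : ℕ) (O : MonomialOrder n) (Z P : List (Poly n)) →
    Reduced O Z P →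
    (q z p : Poly n) → InIdeal O Z z → InCone O P p → q ≃ (z ⊕ p) →
    _≼?_ O (Lm O z) (Lm O q) × _≼?_ O (Lm O p) (Lm O q)
lemma3p8 n O Z P (groebner , P-normal) q z p z∈⟨Z⟩ p∈cone q≃z+p = Lm-z≼Lm-q , Lm-p≼Lm-q
  where
  p-normal : IsNormal O Z p
  p-normal = IsNormal-cone O Z p P-normal p∈cone

  Lm-z≼Lm-q : _≼?_ O (Lm O z) (Lm O q)
  Lm-z≼Lm-q with Lm O z in Lm-z
  ... | nothing = tt
  ... | just a  = occurs⇒≼Lm O q (occurs-resp-≃ q (z ⊕ p) q≃z+p (occurs-⊕ˡ z p p-a≡0 (Lm-occurs O z Lm-z)))
    where
    p-a≡0 : coeff p a ≡ 0ℚ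
    p-a≡0 = coeff-normal-at-Lm-ideal≡0 O Z z p groebner z∈⟨Z⟩ p-normal Lm-z

  Lm-p≼Lm-q : _≼?_ O (Lm O p) (Lm O q)
  Lm-p≼Lm-q with Lm O p in Lm-p
  ... | nothing = tt
  ... | just a with coeff z a ℚ.≟ 0ℚ
  ...   | yes z-a≡0 =
    occurs⇒≼Lm O q (occurs-resp-≃ q (z ⊕ p) q≃z+p (occurs-⊕ʳ z p z-a≡0 (Lm-occurs O p Lm-p)))
  ...   | no occ-z  = ≼?-trans O {just a} {Lm O z} (occurs⇒≼Lm O z occ-z) Lm-z≼Lm-q
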